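{- Let $n,m\ge1$ and $N=n+m-1$. In the ring $R$ described in the context, let $A=[A_{ij}]_{i,j=0}^N$ and $B=[B_{ij}]_{i,j=0}^N$ be the matrices $A_{ij}=\phi^{1-n+j}h_{i-j}$ and $B_{ij}=(-1)^{i-j}\phi^{i-n}e_{i-j}$, with the convention $A_{ij}=B_{ij}=0$ whenever $i$ or $j$ lies outside $\{0,\dots,N\}$. Define $A^\circ=[A^\circ_{ij}]_{i,j=0}^N$ by $A^\circ_{ij}=A_{ij}-A_{i,2n-j}$ if $j<n$ and $A^\circ_{ij}=A_{ij}$ if $j\ge n$, and $B^\times=[B^\times_{ij}]_{i,j=0}^N$ by $B^\times_{ij}=B_{ij}+B_{2n-i,j}$ if $i>n$ and $B^\times_{ij}=B_{ij}$ if $i\le n$. Then $A^\circ$ and $B^\times$ are inverse to each other: $A^\circ B^\times$ is the identity matrix.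
   Context: Let $R$ be the ring (over a field of characteristic $0$) generated by independent indeterminates $h_{rs}$, $r\ge1$, $s\in\mathbb Z$; set $h_{0s}=1$ and $h_{rs}=0$ for $r<0$. Let $\phi$ be the ring automorphism with $\phi(h_{rs})=h_{r,s+1}$, and write $h_r=h_{r0}$, so $h_{rs}=\phi^sh_r$. For a partition $\lambda$ with $\ell(\lambda)\le n'$ put $s_\lambda=\det[\phi^{1-j}h_{\lambda_i-i+j}]_{i,j=1}^{n'}$ (independent of the choice of $n'\ge\ell(\lambda)$). Put $e_r=s_{(1^r)}$ for $r\ge0$ and $e_r=0$ for $r<0$. -}

module Defs where

open import Algebra.Bundles using (CommutativeRing)
open import Data.Bool using (Bool; true; false; if_then_else_; _∧_)
open import Data.Nat as ℕ using (ℕ; zero; suc)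
open import Data.Fin as Fin using (Fin; zero; suc; toℕ; punchIn)
open import Data.Integer as ℤ using (ℤ; +_; -[1+_]; ∣_∣)
open import Relation.Nullary using (does)

-- Everything is parameterised by a commutative ring R and the values
-- h r s ∈ R of the indeterminates.  Convention: the generator h_{r+1,s}
-- of the paper is  h r s  (r : ℕ, s : ℤ).
module Jacobi {c ℓ} (R : CommutativeRing c ℓ) (h : ℕ → ℤ → CommutativeRing.Carrier R) where
  open CommutativeRing R using (Carrier; _+_; _*_; -_; _-_; 0#; 1#)

  Σ : ∀ {k} → (Fin k → Carrier) → Carrier
  Σ {zero}  f = 0#
  Σ {suc k} f = f zero + Σ (λ i → f (suc i))

  sgn : ℕ → Carrier → Carrier
  sgn zero    x = x
  sgn (suc j) x = - sgn j x

  minor : ∀ {k} → (Fin (suc k) → Fin (suc k) → Carrier) → Fin (suc k) →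
          Fin k → Fin k → Carrier
  minor M j a b = M (suc a) (punchIn j b)

  det : ∀ {k} → (Fin k → Fin k → Carrier) → Carrier
  det {zero}  M = 1#
  det {suc k} M = Σ λ j → sgn (toℕ j) (M zero j * det (minor M j))

  -- H r s = h_{rs} with h_{0s} = 1 and h_{rs} = 0 for r < 0
  -- (φ^s h_r = h_{rs}, φ acting by shifting the second index)
  H : ℤ → ℤ → Carrier
  H (+ zero)    s = 1#
  H (+ suc r)   s = h r s
  H -[1+ r ]    s = 0#

  -- φ^k e_r, where e_r = s_{(1^r)} = det[φ^{1-j} h_{1-i+j}]_{i,j=1}^r ;
  -- with 0-based indices a = i-1, b = j-1 the (a,b) entry of φ^k of this
  -- matrix is h_{b-a+1, k-b}.
  Eℕ : ℕ → ℤ → Carrier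
  Eℕ r k = det {r} λ a b → H ((+ toℕ b) ℤ.- (+ toℕ a) ℤ.+ ℤ.1ℤ) (k ℤ.- (+ toℕ b))

  E : ℤ → ℤ → Carrier
  E (+ r)      k = Eℕ r k
  E -[1+ r ]   k = 0#

  module Matrices (n m : ℕ) where
    Nz : ℤ
    Nz = (+ (n ℕ.+ m)) ℤ.- ℤ.1ℤ

    nz : ℤ
    nz = + n

    inRange : ℤ → Bool
    inRange x = does (ℤ.0ℤ ℤ.≤? x) ∧ does (x ℤ.≤? Nz)

    A : ℤ → ℤ → Carrier
    A i j = if inRange i ∧ inRange j
            then H (i ℤ.- j) (ℤ.1ℤ ℤ.- nz ℤ.+ j)
            else 0#

    B : ℤ → ℤ → Carrier
    B i j = if inRange i ∧ inRange j
            then sgn ∣ i ℤ.- j ∣ (E (i ℤ.- j) (i ℤ.- nz))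
            else 0#

    two-n : ℤ
    two-n = (+ 2) ℤ.* nz

    A∘ : ℤ → ℤ → Carrier
    A∘ i j = if does (j ℤ.<? nz)
             then A i j - A i (two-n ℤ.- j)
             else A i j

    B× : ℤ → ℤ → Carrier
    B× i j = if does (nz ℤ.<? i)
             then B i j + B (two-n ℤ.- i) j
             else B i j

    A∘M : Fin (n ℕ.+ m) → Fin (n ℕ.+ m) → Carrier
    A∘M i j = A∘ (+ toℕ i) (+ toℕ j)

    B×M : Fin (n ℕ.+ m) → Fin (n ℕ.+ m) → Carrier
    B×M i j = B× (+ toℕ i) (+ toℕ j)

    product : Fin (n ℕ.+ m) → Fin (n ℕ.+ m) → Carrier
    product i k = Σ λ j → A∘M i j * B×M j k

    identity : Fin (n ℕ.+ m) → Fin (n ℕ.+ m) → Carrier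
    identity i k = if does (i Fin.≟ k) then 1# else 0#

module Submission where

-- Let A and B be the matrices before folding. Both vanish above the diagonal, and for k ≤ i the
-- entry (AB)_{ik} is, with t = k − n and a = i − k, the sum Σ_{r ≤ a} (−1)^r φ^{t+r+1}h_{a−r} φ^{t+r}e_r.
-- For a = 0 it is 1. For a > 0 its last term is (−1)^a φ^{t+a}e_a, and expanding this Hessenberg
-- determinant along its first row yields exactly the negatives of the other terms; so AB = 1.
-- The folding changes nothing: the reflection j ↦ 2n − j carries the terms Σ_{j<n} A_{i,2n−j} B_{jk}
-- subtracted by A° onto the terms Σ_{j>n} A_{ij} B_{2n−j,k} added by B×, the terms whose reflected
-- index leaves {0, …, N} being zero.

open import Defs
open import Algebra.Bundles using (CommutativeMonoid; CommutativeRing)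
open import Data.Bool using (Bool; true; false; if_then_else_; _∧_)
open import Data.Fin as Fin using (Fin)
import Data.Fin.Properties as Finₚ
open import Data.Integer as ℤ using (ℤ; +_; -[1+_])
import Data.Integer.Properties as ℤₚ
open import Data.Integer.Tactic.RingSolver using (solve-∀)
open import Data.Nat as ℕ using (ℕ; zero; suc; _≤_; _<_; _∸_; z≤n; s≤s)
import Data.Nat.Properties as ℕₚ
open import Data.Product using (_,_)
open import Function using (_∘_)
open import Level using (_⊔_)
open import Relation.Binary.Definitions using (Tri; tri<; tri≈; tri>)
open import Relation.Binary.PropositionalEquality as ≡ using (_≡_; _≢_)
open import Relation.Nullary using (yes; no)
open import Relation.Nullary.Decidable using (dec-true; dec-false)

pos-∸ : ∀ {r a} → r ≤ a → + (a ∸ r) ≡ + a ℤ.- + r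
pos-∸ {r} {a} r≤a = ≡.sym (≡.trans (ℤₚ.m-n≡m⊖n a r) (ℤₚ.⊖-≥ r≤a))

i-[1+i+d]≡-[1+d] : ∀ i d → + i ℤ.- + suc (i ℕ.+ d) ≡ -[1+ d ]
i-[1+i+d]≡-[1+d] i d = x-[1+x+y]≡-[1+y] (+ i) (+ d)
  where
  x-[1+x+y]≡-[1+y] : ∀ x y → x ℤ.- (ℤ.1ℤ ℤ.+ (x ℤ.+ y)) ≡ ℤ.- (ℤ.1ℤ ℤ.+ y)
  x-[1+x+y]≡-[1+y] = solve-∀

module NatIndexedSum {a ℓ} (M : CommutativeMonoid a ℓ) where
  open CommutativeMonoid M renaming (_∙_ to _+_; ε to 0#; ∙-cong to +-cong;
    ∙-congˡ to +-congˡ; identityˡ to +-identityˡ; identityʳ to +-identityʳ; assoc to +-assoc)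
  open import Algebra.Properties.CommutativeSemigroup commutativeSemigroup using (interchange)
  open import Relation.Binary.Reasoning.Setoid setoid

  ∑ : ℕ → (ℕ → Carrier) → Carrier
  ∑ zero    f = 0#
  ∑ (suc k) f = f 0 + ∑ k (λ i → f (suc i))

  ∑-cong< : ∀ k {f g : ℕ → Carrier} → (∀ i → i < k → f i ≈ g i) → ∑ k f ≈ ∑ k g
  ∑-cong< zero    f≈g = refl
  ∑-cong< (suc k) f≈g = +-cong (f≈g 0 (s≤s z≤n)) (∑-cong< k (λ i i<k → f≈g (suc i) (s≤s i<k)))

  ∑-cong : ∀ k {f g : ℕ → Carrier} → (∀ i → f i ≈ g i) → ∑ k f ≈ ∑ k g
  ∑-cong k f≈g = ∑-cong< k (λ i _ → f≈g i)

  ∑-zero< : ∀ k {f : ℕ → Carrier} → (∀ i → i < k → f i ≈ 0#) → ∑ k f ≈ 0#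
  ∑-zero< zero    f≈0 = refl
  ∑-zero< (suc k) f≈0 =
    trans (+-cong (f≈0 0 (s≤s z≤n)) (∑-zero< k (λ i i<k → f≈0 (suc i) (s≤s i<k)))) (+-identityˡ 0#)

  ∑-distrib-+ : ∀ k (f g : ℕ → Carrier) → ∑ k (λ i → f i + g i) ≈ ∑ k f + ∑ k g
  ∑-distrib-+ zero    f g = sym (+-identityˡ 0#)
  ∑-distrib-+ (suc k) f g = trans (+-congˡ (∑-distrib-+ k _ _)) (interchange _ _ _ _)

  ∑-split : ∀ k l (f : ℕ → Carrier) → ∑ (k ℕ.+ l) f ≈ ∑ k f + ∑ l (λ i → f (k ℕ.+ i))
  ∑-split zero    l f = sym (+-identityˡ _)
  ∑-split (suc k) l f = trans (+-congˡ (∑-split k l _)) (sym (+-assoc _ _ _))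

  ∑-vanishing-tail : ∀ k l (f : ℕ → Carrier) → (∀ i → i < l → f (k ℕ.+ i) ≈ 0#) →
                     ∑ (k ℕ.+ l) f ≈ ∑ k f
  ∑-vanishing-tail k l f tail≈0 = trans (∑-split k l f) (trans (+-congˡ (∑-zero< l tail≈0)) (+-identityʳ _))

  ∑-init-last : ∀ k (f : ℕ → Carrier) → ∑ (suc k) f ≈ ∑ k f + f k
  ∑-init-last zero    f = trans (+-identityʳ _) (sym (+-identityˡ _))
  ∑-init-last (suc k) f = trans (+-congˡ (∑-init-last k _)) (sym (+-assoc _ _ _))

  ∑-reverse : ∀ k (f : ℕ → Carrier) → ∑ k f ≈ ∑ k (λ i → f (k ∸ suc i))
  ∑-reverse zero    f = refl
  ∑-reverse (suc k) f = begin
    f 0 + ∑ k (λ i → f (suc i))            ≈⟨ +-congˡ (∑-reverse k _) ⟩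
    f 0 + ∑ k (λ i → f (suc (k ∸ suc i)))  ≈⟨ comm _ _ ⟩
    ∑ k (λ i → f (suc (k ∸ suc i))) + f 0
      ≈⟨ +-cong (∑-cong< k (λ i i<k → reflexive (≡.cong f (suc[k∸1+i]≡k∸i i<k))))
                (reflexive (≡.cong f (≡.sym (ℕₚ.n∸n≡0 k)))) ⟩
    ∑ k (λ i → f (k ∸ i)) + f (k ∸ k)      ≈⟨ ∑-init-last k _ ⟨
    ∑ (suc k) (λ i → f (suc k ∸ suc i))    ∎
    where
    suc[k∸1+i]≡k∸i : ∀ {i} → i < k → suc (k ∸ suc i) ≡ k ∸ i
    suc[k∸1+i]≡k∸i i<k = ≡.sym (ℕₚ.+-∸-assoc 1 i<k)

module JacobiProperties {c ℓ} (R : CommutativeRing c ℓ) (h : ℕ → ℤ → CommutativeRing.Carrier R) where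
  open CommutativeRing R
  open Jacobi R h
  open NatIndexedSum +-commutativeMonoid
  open import Algebra.Properties.Ring ring using (-‿distribʳ-*; -0#≈0#; -‿involutive; -‿+-comm; -‿distribˡ-*)
  open import Algebra.Properties.CommutativeSemigroup +-commutativeSemigroup using (interchange)
  open import Relation.Binary.Reasoning.Setoid setoid

  ∑-neg : ∀ k (f : ℕ → Carrier) → ∑ k (λ i → - f i) ≈ - ∑ k f
  ∑-neg zero    f = sym -0#≈0#
  ∑-neg (suc k) f = trans (+-congˡ (∑-neg k _)) (-‿+-comm _ _)

  Σ≡∑ : ∀ k (f : ℕ → Carrier) → Σ {k} (λ j → f (Fin.toℕ j)) ≡ ∑ k f
  Σ≡∑ zero    f = ≡.refl
  Σ≡∑ (suc k) f = ≡.cong (λ s → f 0 + s) (Σ≡∑ k (λ i → f (suc i)))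

  sgn-+ : ∀ a b x → sgn (a ℕ.+ b) x ≡ sgn a (sgn b x)
  sgn-+ zero    b x = ≡.refl
  sgn-+ (suc a) b x = ≡.cong -_ (sgn-+ a b x)

  sgn-cong : ∀ a {x y} → x ≈ y → sgn a x ≈ sgn a y
  sgn-cong zero    x≈y = x≈y
  sgn-cong (suc a) x≈y = -‿cong (sgn-cong a x≈y)

  sgn-neg : ∀ a x → sgn a (- x) ≈ - sgn a x
  sgn-neg zero    x = refl
  sgn-neg (suc a) x = -‿cong (sgn-neg a x)

  sgn-involutive : ∀ a x → sgn a (sgn a x) ≈ x
  sgn-involutive zero    x = refl
  sgn-involutive (suc a) x = begin
    - sgn a (- sgn a x)  ≈⟨ -‿cong (sgn-neg a _) ⟩
    - - sgn a (sgn a x)  ≈⟨ -‿involutive _ ⟩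
    sgn a (sgn a x)      ≈⟨ sgn-involutive a x ⟩
    x                    ∎

  sgn-distribʳ-* : ∀ a x y → sgn a (x * y) ≈ x * sgn a y
  sgn-distribʳ-* zero    x y = refl
  sgn-distribʳ-* (suc a) x y = trans (-‿cong (sgn-distribʳ-* a x y)) (-‿distribʳ-* x _)

  sgn-zero : ∀ a → sgn a 0# ≈ 0#
  sgn-zero zero    = refl
  sgn-zero (suc a) = trans (-‿cong (sgn-zero a)) -0#≈0#

  sgn-∑ : ∀ a k f → sgn a (∑ k f) ≈ ∑ k (λ i → sgn a (f i))
  sgn-∑ zero    k f = refl
  sgn-∑ (suc a) k f = trans (-‿cong (sgn-∑ a k f)) (sym (∑-neg k _))

  Σ-cong : ∀ {k} {f g : Fin k → Carrier} → (∀ i → f i ≈ g i) → Σ f ≈ Σ g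
  Σ-cong {zero}  f≈g = refl
  Σ-cong {suc k} f≈g = +-cong (f≈g Fin.zero) (Σ-cong (λ i → f≈g (Fin.suc i)))

  Σ-zero : ∀ {k} {f : Fin k → Carrier} → (∀ i → f i ≈ 0#) → Σ f ≈ 0#
  Σ-zero {zero}  f≈0 = refl
  Σ-zero {suc k} f≈0 = trans (+-cong (f≈0 Fin.zero) (Σ-zero (λ i → f≈0 (Fin.suc i)))) (+-identityˡ 0#)

  det-cong : ∀ {k} {M N : Fin k → Fin k → Carrier} → (∀ a b → M a b ≈ N a b) → det M ≈ det N
  det-cong {zero}  M≈N = refl
  det-cong {suc k} M≈N = Σ-cong (λ j → sgn-cong (Fin.toℕ j)
    (*-cong (M≈N Fin.zero j) (det-cong (λ a b → M≈N (Fin.suc a) (Fin.punchIn j b)))))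

  det-zero-column : ∀ k (M : Fin (suc k) → Fin (suc k) → Carrier) → (∀ a → M a Fin.zero ≈ 0#) → det M ≈ 0#
  expansion-tail≈0 : ∀ k (M : Fin (suc k) → Fin (suc k) → Carrier) → (∀ a → M (Fin.suc a) Fin.zero ≈ 0#) →
    Σ (λ j → sgn (Fin.toℕ (Fin.suc j)) (M Fin.zero (Fin.suc j) * det (minor M (Fin.suc j)))) ≈ 0#

  det-zero-column k M col≈0 =
    trans (+-cong (trans (*-congʳ (col≈0 Fin.zero)) (zeroˡ _)) (expansion-tail≈0 k M (col≈0 ∘ Fin.suc)))
          (+-identityˡ 0#)

  -- Every minor M(0 | j+1) keeps the first column of M below row 0, which vanishes.
  expansion-tail≈0 zero    M col≈0 = refl
  expansion-tail≈0 (suc k) M col≈0 = Σ-zero λ j →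
    let minor≈0 = det-zero-column k (minor M (Fin.suc j)) col≈0
    in trans (sgn-cong (suc (Fin.toℕ j)) (trans (*-congˡ {M Fin.zero (Fin.suc j)} minor≈0) (zeroʳ _)))
             (sgn-zero (suc (Fin.toℕ j)))

  det-unit-column : ∀ k (M : Fin (suc k) → Fin (suc k) → Carrier) → M Fin.zero Fin.zero ≈ 1# →
                    (∀ a → M (Fin.suc a) Fin.zero ≈ 0#) → det M ≈ det (λ a b → M (Fin.suc a) (Fin.suc b))
  det-unit-column k M M00≈1 col≈0 =
    trans (+-cong (trans (*-congʳ M00≈1) (*-identityˡ _)) (expansion-tail≈0 k M col≈0)) (+-identityʳ _)

  toMatrix : ∀ r → (ℕ → ℕ → Carrier) → Fin r → Fin r → Carrier
  toMatrix r P a b = P (Fin.toℕ a) (Fin.toℕ b)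

  drop : ℕ → (ℕ → ℕ → Carrier) → ℕ → ℕ → Carrier
  drop j P a b = P (j ℕ.+ a) (j ℕ.+ b)

  record UnitHessenberg (P : ℕ → ℕ → Carrier) : Set (c ⊔ ℓ) where
    field
      subdiagonal : ∀ a → P (suc a) a ≈ 1#
      below       : ∀ a b → b < a → P (suc a) b ≈ 0#
  open UnitHessenberg

  drop-unitHessenberg : ∀ {P} → UnitHessenberg P → UnitHessenberg (drop 1 P)
  drop-unitHessenberg hess .subdiagonal a     = hess .subdiagonal (suc a)
  drop-unitHessenberg hess .below       a b q = hess .below (suc a) (suc b) (s≤s q)

  -- Deleting row 0 and column j leaves a block triangular matrix whose upper-left block is
  -- triangular with unit diagonal, so the minor is the complementary lower-right block.
  det-minor-unitHessenberg : ∀ r (j : Fin (suc r)) P → UnitHessenberg P →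
    det (minor (toMatrix (suc r) P) j) ≈ det (toMatrix (r ∸ Fin.toℕ j) (drop (suc (Fin.toℕ j)) P))
  det-minor-unitHessenberg r       Fin.zero    P hess = refl
  det-minor-unitHessenberg (suc r) (Fin.suc j) P hess =
    trans (det-unit-column r (minor (toMatrix (suc (suc r)) P) (Fin.suc j))
                           (hess .subdiagonal 0) (λ a → hess .below (suc (Fin.toℕ a)) 0 (s≤s z≤n)))
          (det-minor-unitHessenberg r j (drop 1 P) (drop-unitHessenberg hess))

  det-unitHessenberg : ∀ r P → UnitHessenberg P →
    det (toMatrix (suc r) P) ≈ ∑ (suc r) (λ j → sgn j (P 0 j * det (toMatrix (r ∸ j) (drop (suc j) P))))
  det-unitHessenberg r P hess = trans
    (Σ-cong (λ j → sgn-cong (Fin.toℕ j) (*-congˡ {P 0 (Fin.toℕ j)} (det-minor-unitHessenberg r j P hess))))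
    (reflexive (Σ≡∑ (suc r) (λ j → sgn j (P 0 j * det (toMatrix (r ∸ j) (drop (suc j) P))))))

  eMatrix : ℤ → ℕ → ℕ → Carrier
  eMatrix K a b = H (+ b ℤ.- + a ℤ.+ ℤ.1ℤ) (K ℤ.- + b)

  eMatrix-unitHessenberg : ∀ K → UnitHessenberg (eMatrix K)
  eMatrix-unitHessenberg K .subdiagonal a = reflexive (≡.cong (λ z → H z (K ℤ.- + a)) (x-[1+x]+1≡0 (+ a)))
    where
    x-[1+x]+1≡0 : ∀ x → x ℤ.- (ℤ.1ℤ ℤ.+ x) ℤ.+ ℤ.1ℤ ≡ ℤ.0ℤ
    x-[1+x]+1≡0 = solve-∀
  eMatrix-unitHessenberg K .below a b b<a with ℕₚ.m≤n⇒∃[o]m+o≡n b<a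
  ... | d , ≡.refl = reflexive (≡.cong (λ z → H z (K ℤ.- + b)) (x-[2+x+y]+1≡-[1+y] (+ b) (+ d)))
    where
    x-[2+x+y]+1≡-[1+y] : ∀ x y → x ℤ.- (ℤ.1ℤ ℤ.+ (ℤ.1ℤ ℤ.+ (x ℤ.+ y))) ℤ.+ ℤ.1ℤ ≡ ℤ.- (ℤ.1ℤ ℤ.+ y)
    x-[2+x+y]+1≡-[1+y] = solve-∀

  drop-eMatrix : ∀ j K a b → drop j (eMatrix K) a b ≡ eMatrix (K ℤ.- + j) a b
  drop-eMatrix j K a b = ≡.cong₂ H (shift-invariant (+ j) (+ a) (+ b)) (reassoc K (+ j) (+ b))
    where
    shift-invariant : ∀ x y z → (x ℤ.+ z) ℤ.- (x ℤ.+ y) ℤ.+ ℤ.1ℤ ≡ z ℤ.- y ℤ.+ ℤ.1ℤ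
    shift-invariant = solve-∀
    reassoc : ∀ x y z → x ℤ.- (y ℤ.+ z) ≡ x ℤ.- y ℤ.- z
    reassoc = solve-∀

  E-firstRowExpansion : ∀ r K → Eℕ (suc r) K ≈
    ∑ (suc r) (λ j → sgn j (H (+ suc j) (K ℤ.- + j) * Eℕ (r ∸ j) (K ℤ.- + suc j)))
  E-firstRowExpansion r K = trans (det-unitHessenberg r (eMatrix K) (eMatrix-unitHessenberg K))
    (∑-cong (suc r) (λ j → sgn-cong j (*-cong (reflexive (first-row j)) (complementary-minor j))))
    where
    x-0+1≡1+x : ∀ x → x ℤ.- ℤ.0ℤ ℤ.+ ℤ.1ℤ ≡ ℤ.1ℤ ℤ.+ x
    x-0+1≡1+x = solve-∀
    first-row : ∀ j → eMatrix K 0 j ≡ H (+ suc j) (K ℤ.- + j)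
    first-row j = ≡.cong (λ z → H z (K ℤ.- + j)) (x-0+1≡1+x (+ j))
    complementary-minor : ∀ j → det (toMatrix (r ∸ j) (drop (suc j) (eMatrix K))) ≈ Eℕ (r ∸ j) (K ℤ.- + suc j)
    complementary-minor j = det-cong {r ∸ j} (λ a b → reflexive (drop-eMatrix (suc j) K (Fin.toℕ a) (Fin.toℕ b)))

  heTerm : ℤ → ℕ → ℕ → Carrier
  heTerm t a r = H (+ (a ∸ r)) (t ℤ.+ + suc r) * sgn r (Eℕ r (t ℤ.+ + r))

  ∑-heTerm-zero : ∀ t → ∑ 1 (heTerm t 0) ≈ 1#
  ∑-heTerm-zero t = trans (+-identityʳ _) (*-identityˡ 1#)

  -- The expansion of e_{a+1} along its first row, read backwards, reproduces all terms but the last.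
  sgn-E≈∑-heTerm : ∀ t a → sgn a (Eℕ (suc a) (t ℤ.+ + suc a)) ≈ ∑ (suc a) (heTerm t (suc a))
  sgn-E≈∑-heTerm t a = begin
    sgn a (Eℕ (suc a) K)                       ≈⟨ sgn-cong a (E-firstRowExpansion a K) ⟩
    sgn a (∑ (suc a) term)                     ≈⟨ sgn-cong a (∑-reverse (suc a) term) ⟩
    sgn a (∑ (suc a) (λ r → term (a ∸ r)))     ≈⟨ sgn-∑ a (suc a) (λ r → term (a ∸ r)) ⟩
    ∑ (suc a) (λ r → sgn a (term (a ∸ r)))     ≈⟨ ∑-cong< (suc a) reversed-term ⟩
    ∑ (suc a) (heTerm t (suc a))               ∎
    where
    K = t ℤ.+ + suc a
    term : ℕ → Carrier
    term j = sgn j (H (+ suc j) (K ℤ.- + j) * Eℕ (a ∸ j) (K ℤ.- + suc j))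

    reversed-term : ∀ r → r < suc a → sgn a (term (a ∸ r)) ≈ heTerm t (suc a) r
    reversed-term r (s≤s r≤a) = begin
      sgn a (sgn d X)                ≡⟨ ≡.cong (λ z → sgn z (sgn d X)) (≡.sym (ℕₚ.m+[n∸m]≡n r≤a)) ⟩
      sgn (r ℕ.+ d) (sgn d X)        ≡⟨ sgn-+ r d (sgn d X) ⟩
      sgn r (sgn d (sgn d X))        ≈⟨ sgn-cong r (sgn-involutive d X) ⟩
      sgn r X                        ≈⟨ sgn-distribʳ-* r _ _ ⟩
      H (+ suc d) (K ℤ.- + d) * sgn r (Eℕ (a ∸ d) (K ℤ.- + suc d))
        ≡⟨ ≡.cong₂ _*_ (≡.cong₂ H h-degree h-shift) (≡.cong₂ (λ s z → sgn r (Eℕ s z)) (ℕₚ.m∸[m∸n]≡n r≤a) e-shift) ⟩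
      heTerm t (suc a) r             ∎
      where
      d = a ∸ r
      X = H (+ suc d) (K ℤ.- + d) * Eℕ (a ∸ d) (K ℤ.- + suc d)
      h-degree : + suc d ≡ + (suc a ∸ r)
      h-degree = ≡.cong +_ (≡.sym (ℕₚ.+-∸-assoc 1 r≤a))
      t+[1+a]-[a-r]≡t+[1+r] : ∀ t a r → t ℤ.+ (ℤ.1ℤ ℤ.+ a) ℤ.- (a ℤ.- r) ≡ t ℤ.+ (ℤ.1ℤ ℤ.+ r)
      t+[1+a]-[a-r]≡t+[1+r] = solve-∀
      h-shift : K ℤ.- + d ≡ t ℤ.+ + suc r
      h-shift = ≡.trans (≡.cong (λ z → K ℤ.- z) (pos-∸ r≤a)) (t+[1+a]-[a-r]≡t+[1+r] t (+ a) (+ r))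
      t+[1+a]-[1+a-r]≡t+r : ∀ t a r → t ℤ.+ (ℤ.1ℤ ℤ.+ a) ℤ.- (ℤ.1ℤ ℤ.+ (a ℤ.- r)) ≡ t ℤ.+ r
      t+[1+a]-[1+a-r]≡t+r = solve-∀
      e-shift : K ℤ.- + suc d ≡ t ℤ.+ + r
      e-shift = ≡.trans (≡.cong (λ z → K ℤ.- (ℤ.1ℤ ℤ.+ z)) (pos-∸ r≤a))
                        (t+[1+a]-[1+a-r]≡t+r t (+ a) (+ r))

  ∑-heTerm-suc : ∀ t a → ∑ (suc (suc a)) (heTerm t (suc a)) ≈ 0#
  ∑-heTerm-suc t a = begin
    ∑ (suc (suc a)) F                       ≈⟨ ∑-init-last (suc a) F ⟩
    ∑ (suc a) F + F (suc a)                 ≈⟨ +-congˡ last-term ⟩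
    ∑ (suc a) F + - sgn a (Eℕ (suc a) K)    ≈⟨ +-congˡ (-‿cong (sgn-E≈∑-heTerm t a)) ⟩
    ∑ (suc a) F + - ∑ (suc a) F             ≈⟨ -‿inverseʳ _ ⟩
    0#                                      ∎
    where
    F = heTerm t (suc a)
    K = t ℤ.+ + suc a
    last-term : F (suc a) ≈ - sgn a (Eℕ (suc a) K)
    last-term = trans (*-congʳ (reflexive (≡.cong (λ z → H (+ z) (t ℤ.+ + suc (suc a))) (ℕₚ.n∸n≡0 a))))
                      (*-identityˡ _)

  [x-u]+[y+[z+u]]≈x+[y+z] : ∀ x u y z → (x - u) + (y + (z + u)) ≈ x + (y + z)
  [x-u]+[y+[z+u]]≈x+[y+z] x u y z = begin
    (x - u) + (y + (z + u))   ≈⟨ interchange x (- u) y (z + u) ⟩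
    (x + y) + (- u + (z + u)) ≈⟨ +-congˡ (+-congˡ (+-comm z u)) ⟩
    (x + y) + (- u + (u + z)) ≈⟨ +-congˡ (+-assoc (- u) u z) ⟨
    (x + y) + ((- u + u) + z) ≈⟨ +-congˡ (+-congʳ (-‿inverseˡ u)) ⟩
    (x + y) + (0# + z)        ≈⟨ +-congˡ (+-identityˡ z) ⟩
    (x + y) + z               ≈⟨ +-assoc x y z ⟩
    x + (y + z)               ∎

  if-then-0# : ∀ (b : Bool) {x} → x ≈ 0# → (if b then x else 0#) ≈ 0#
  if-then-0# true  x≈0 = x≈0
  if-then-0# false x≈0 = refl

  module Entries (n m′ : ℕ) where
    open Matrices n (suc m′)

    size : ℕ
    size = n ℕ.+ suc m′

    inRange-pos : ∀ {x} → x < size → inRange (+ x) ≡ true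
    inRange-pos {x} x<size =
      ≡.cong₂ _∧_ (dec-true (ℤ.0ℤ ℤ.≤? + x) (ℤ.+≤+ z≤n)) (dec-true (+ x ℤ.≤? Nz) x≤N)
      where
      x+[1+y]-1≡x+y : ∀ x y → x ℤ.+ (ℤ.1ℤ ℤ.+ y) ℤ.- ℤ.1ℤ ≡ x ℤ.+ y
      x+[1+y]-1≡x+y = solve-∀
      x≤N : + x ℤ.≤ Nz
      x≤N = ≡.subst (+ x ℤ.≤_) (≡.sym (x+[1+y]-1≡x+y (+ n) (+ m′)))
                    (ℤ.+≤+ (ℕ.s≤s⁻¹ (≡.subst (x <_) (ℕₚ.+-suc n m′) x<size)))

    A-inRange : ∀ {i j} → i < size → j < size → A (+ i) (+ j) ≡ H (+ i ℤ.- + j) (ℤ.1ℤ ℤ.- + n ℤ.+ + j)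
    A-inRange {i} {j} i<size j<size =
      ≡.cong₂ (λ p q → if p ∧ q then H (+ i ℤ.- + j) (ℤ.1ℤ ℤ.- + n ℤ.+ + j) else 0#)
              (inRange-pos i<size) (inRange-pos j<size)

    B-inRange : ∀ {j k} → j < size → k < size →
            B (+ j) (+ k) ≡ sgn ℤ.∣ + j ℤ.- + k ∣ (E (+ j ℤ.- + k) (+ j ℤ.- + n))
    B-inRange {j} {k} j<size k<size =
      ≡.cong₂ (λ p q → if p ∧ q then sgn ℤ.∣ + j ℤ.- + k ∣ (E (+ j ℤ.- + k) (+ j ℤ.- + n)) else 0#)
              (inRange-pos j<size) (inRange-pos k<size)

    A-above-diagonal : ∀ {i j} → i < j → A (+ i) (+ j) ≈ 0#
    A-above-diagonal {i} i<j with ℕₚ.m≤n⇒∃[o]m+o≡n i<j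
    ... | d , ≡.refl = if-then-0# (inRange (+ i) ∧ inRange (+ suc (i ℕ.+ d)))
                         (reflexive (≡.cong (λ z → H z (ℤ.1ℤ ℤ.- + n ℤ.+ + suc (i ℕ.+ d))) (i-[1+i+d]≡-[1+d] i d)))

    B-above-diagonal : ∀ {j k} → j < k → B (+ j) (+ k) ≈ 0#
    B-above-diagonal {j} j<k with ℕₚ.m≤n⇒∃[o]m+o≡n j<k
    ... | d , ≡.refl = if-then-0# (inRange (+ j) ∧ inRange (+ suc (j ℕ.+ d)))
                         (trans (sgn-cong ∣j-k∣ (reflexive (≡.cong (λ z → E z (+ j ℤ.- + n)) (i-[1+i+d]≡-[1+d] j d))))
                                (sgn-zero ∣j-k∣))
      where ∣j-k∣ = ℤ.∣ + j ℤ.- + suc (j ℕ.+ d) ∣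

    A∘-< : ∀ I {j} → j < n → A∘ I (+ j) ≡ A I (+ j) - A I (two-n ℤ.- + j)
    A∘-< I {j} j<n = ≡.cong (λ p → if p then A I (+ j) - A I (two-n ℤ.- + j) else A I (+ j))
                            (dec-true (+ j ℤ.<? + n) (ℤ.+<+ j<n))

    A∘-≥ : ∀ I {j} → n ≤ j → A∘ I (+ j) ≡ A I (+ j)
    A∘-≥ I {j} n≤j = ≡.cong (λ p → if p then A I (+ j) - A I (two-n ℤ.- + j) else A I (+ j))
                            (dec-false (+ j ℤ.<? + n) (ℤₚ.≤⇒≯ (ℤ.+≤+ n≤j)))

    B×-> : ∀ {j} K → n < j → B× (+ j) K ≡ B (+ j) K + B (two-n ℤ.- + j) K
    B×-> {j} K n<j = ≡.cong (λ p → if p then B (+ j) K + B (two-n ℤ.- + j) K else B (+ j) K)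
                            (dec-true (+ n ℤ.<? + j) (ℤ.+<+ n<j))

    B×-≤ : ∀ {j} K → j ≤ n → B× (+ j) K ≡ B (+ j) K
    B×-≤ {j} K j≤n = ≡.cong (λ p → if p then B (+ j) K + B (two-n ℤ.- + j) K else B (+ j) K)
                            (dec-false (+ n ℤ.<? + j) (ℤₚ.≤⇒≯ (ℤ.+≤+ j≤n)))

    abTerm : ℕ → ℕ → ℕ → Carrier
    abTerm i k j = A (+ i) (+ j) * B (+ j) (+ k)

    AB-above-diagonal : ∀ {i k} → i < k → ∑ size (abTerm i k) ≈ 0#
    AB-above-diagonal {i} {k} i<k = ∑-zero< size term≈0
      where
      term≈0 : ∀ j → j < size → abTerm i k j ≈ 0#
      term≈0 j _ with j ℕ.<? k
      ... | yes j<k = trans (*-congˡ (B-above-diagonal j<k)) (zeroʳ _)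
      ... | no  j≮k = trans (*-congʳ (A-above-diagonal (ℕₚ.<-≤-trans i<k (ℕₚ.≮⇒≥ j≮k)))) (zeroˡ _)

    abTerm≡heTerm : ∀ {k a r} → k ℕ.+ a < size → r ≤ a →
                    abTerm (k ℕ.+ a) k (k ℕ.+ r) ≡ heTerm (+ k ℤ.- + n) a r
    abTerm≡heTerm {k} {a} {r} k+a<size r≤a = ≡.cong₂ _*_
      (≡.trans (A-inRange k+a<size k+r<size) (≡.cong₂ H h-degree h-shift))
      (≡.trans (B-inRange k+r<size k<size) (≡.cong₂ (λ z w → sgn ℤ.∣ z ∣ (E z w)) e-degree e-shift))
      where
      k+r<size : k ℕ.+ r < size
      k+r<size = ℕₚ.≤-<-trans (ℕₚ.+-monoʳ-≤ k r≤a) k+a<size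
      k<size : k < size
      k<size = ℕₚ.≤-<-trans (ℕₚ.m≤m+n k r) k+r<size
      [x+y]-[x+z]≡y-z : ∀ x y z → (x ℤ.+ y) ℤ.- (x ℤ.+ z) ≡ y ℤ.- z
      [x+y]-[x+z]≡y-z = solve-∀
      h-degree : + (k ℕ.+ a) ℤ.- + (k ℕ.+ r) ≡ + (a ∸ r)
      h-degree = ≡.trans ([x+y]-[x+z]≡y-z (+ k) (+ a) (+ r)) (≡.sym (pos-∸ r≤a))
      1-x+[y+z]≡[y-x]+[1+z] : ∀ x y z → ℤ.1ℤ ℤ.- x ℤ.+ (y ℤ.+ z) ≡ (y ℤ.- x) ℤ.+ (ℤ.1ℤ ℤ.+ z)
      1-x+[y+z]≡[y-x]+[1+z] = solve-∀
      h-shift : ℤ.1ℤ ℤ.- + n ℤ.+ + (k ℕ.+ r) ≡ (+ k ℤ.- + n) ℤ.+ + suc r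
      h-shift = 1-x+[y+z]≡[y-x]+[1+z] (+ n) (+ k) (+ r)
      [x+y]-x≡y : ∀ x y → (x ℤ.+ y) ℤ.- x ≡ y
      [x+y]-x≡y = solve-∀
      e-degree : + (k ℕ.+ r) ℤ.- + k ≡ + r
      e-degree = [x+y]-x≡y (+ k) (+ r)
      [y+z]-x≡[y-x]+z : ∀ x y z → (y ℤ.+ z) ℤ.- x ≡ (y ℤ.- x) ℤ.+ z
      [y+z]-x≡[y-x]+z = solve-∀
      e-shift : + (k ℕ.+ r) ℤ.- + n ≡ (+ k ℤ.- + n) ℤ.+ + r
      e-shift = [y+z]-x≡[y-x]+z (+ n) (+ k) (+ r)

    AB≈∑heTerm : ∀ {i k a} → i ≡ k ℕ.+ a → i < size →
                 ∑ size (abTerm i k) ≈ ∑ (suc a) (heTerm (+ k ℤ.- + n) a)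
    AB≈∑heTerm {k = k} {a} ≡.refl k+a<size with ℕₚ.m≤n⇒∃[o]m+o≡n k+a<size
    ... | e , k+a+1+e≡size = begin
      ∑ size f                                      ≡⟨ ≡.cong (λ z → ∑ z f) size≡ ⟩
      ∑ (k ℕ.+ (suc a ℕ.+ e)) f                     ≈⟨ ∑-split k (suc a ℕ.+ e) f ⟩
      ∑ k f + ∑ (suc a ℕ.+ e) (λ j → f (k ℕ.+ j))
        ≈⟨ +-cong (∑-zero< k below-k) (∑-vanishing-tail (suc a) e (λ j → f (k ℕ.+ j)) beyond-k+a) ⟩
      0# + ∑ (suc a) (λ j → f (k ℕ.+ j))            ≈⟨ +-identityˡ _ ⟩
      ∑ (suc a) (λ j → f (k ℕ.+ j))
        ≈⟨ ∑-cong< (suc a) (λ { r (s≤s r≤a) → reflexive (abTerm≡heTerm k+a<size r≤a) }) ⟩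
      ∑ (suc a) (heTerm (+ k ℤ.- + n) a)            ∎
      where
      f = abTerm (k ℕ.+ a) k
      size≡ : size ≡ k ℕ.+ (suc a ℕ.+ e)
      size≡ = ≡.trans (≡.sym k+a+1+e≡size)
                      (≡.trans (≡.cong suc (ℕₚ.+-assoc k a e)) (≡.sym (ℕₚ.+-suc k (a ℕ.+ e))))
      below-k : ∀ j → j < k → f j ≈ 0#
      below-k j j<k = trans (*-congˡ (B-above-diagonal j<k)) (zeroʳ _)
      beyond-k+a : ∀ d → d < e → f (k ℕ.+ (suc a ℕ.+ d)) ≈ 0#
      beyond-k+a d _ = trans (*-congʳ (A-above-diagonal (ℕₚ.+-monoʳ-< k (s≤s (ℕₚ.m≤m+n a d))))) (zeroˡ _)

    AB-diagonal : ∀ {k} → k < size → ∑ size (abTerm k k) ≈ 1#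
    AB-diagonal {k} k<size =
      trans (AB≈∑heTerm (≡.sym (ℕₚ.+-identityʳ k)) k<size) (∑-heTerm-zero (+ k ℤ.- + n))

    AB-below-diagonal : ∀ {i k} → k < i → i < size → ∑ size (abTerm i k) ≈ 0#
    AB-below-diagonal {i} {k} k<i i<size with ℕₚ.m≤n⇒∃[o]m+o≡n k<i
    ... | a , 1+k+a≡i =
      trans (AB≈∑heTerm (≡.trans (≡.sym 1+k+a≡i) (≡.sym (ℕₚ.+-suc k a))) i<size) (∑-heTerm-suc (+ k ℤ.- + n) a)

    foldedTerm A∘-correction B×-correction : ℕ → ℕ → ℕ → Carrier
    foldedTerm    i k j = A∘ (+ i) (+ j) * B× (+ j) (+ k)
    A∘-correction i k j = A (+ i) (two-n ℤ.- + j) * B (+ j) (+ k)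
    B×-correction i k j = A (+ i) (+ j) * B (two-n ℤ.- + j) (+ k)

    -- Both sides are Σ_d A_{i,n+1+d} B_{n−1−d,k}, over d < m′ on the left and d < n on the right; the
    -- terms with n + 1 + d > N vanish as A is zero above the diagonal, those with n − 1 − d < 0 as B is
    -- zero outside {0, …, N}.
    ∑-reflect : ∀ {i} k → i < size →
                ∑ m′ (λ d → B×-correction i k (n ℕ.+ suc d)) ≈ ∑ n (A∘-correction i k)
    ∑-reflect {i} k i<size = begin
      ∑ m′ (λ d → B×-correction i k (n ℕ.+ suc d)) ≈⟨ ∑-cong m′ (λ d → reflexive (≡.cong (B-at (n ℕ.+ suc d)) (folded d))) ⟩
      ∑ m′ w                                       ≈⟨ ∑-vanishing-tail m′ n w A-vanishes ⟨
      ∑ (m′ ℕ.+ n) w                               ≡⟨ ≡.cong (λ z → ∑ z w) (ℕₚ.+-comm m′ n) ⟩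
      ∑ (n ℕ.+ m′) w                               ≈⟨ ∑-vanishing-tail n m′ w B-vanishes ⟩
      ∑ n w                                        ≈⟨ ∑-cong< n (λ d d<n → reflexive (reflected d<n)) ⟩
      ∑ n (λ d → A∘-correction i k (n ∸ suc d))    ≈⟨ ∑-reverse n (A∘-correction i k) ⟨
      ∑ n (A∘-correction i k)                      ∎
      where
      B-at : ℕ → ℤ → Carrier
      B-at j z = A (+ i) (+ j) * B z (+ k)
      w : ℕ → Carrier
      w d = B-at (n ℕ.+ suc d) (+ n ℤ.- + suc d)
      2x-[x+[1+y]]≡x-[1+y] : ∀ x y → (+ 2) ℤ.* x ℤ.- (x ℤ.+ (ℤ.1ℤ ℤ.+ y)) ≡ x ℤ.- (ℤ.1ℤ ℤ.+ y)
      2x-[x+[1+y]]≡x-[1+y] = solve-∀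
      folded : ∀ d → two-n ℤ.- + (n ℕ.+ suc d) ≡ + n ℤ.- + suc d
      folded d = 2x-[x+[1+y]]≡x-[1+y] (+ n) (+ d)
      2x-[x-[1+y]]≡x+[1+y] : ∀ x y → (+ 2) ℤ.* x ℤ.- (x ℤ.- (ℤ.1ℤ ℤ.+ y)) ≡ x ℤ.+ (ℤ.1ℤ ℤ.+ y)
      2x-[x-[1+y]]≡x+[1+y] = solve-∀
      reflected : ∀ {d} → suc d ≤ n → w d ≡ A∘-correction i k (n ∸ suc d)
      reflected {d} d<n = ≡.sym (≡.cong₂ (λ y z → A (+ i) y * B z (+ k))
        (≡.trans (≡.cong (λ z → two-n ℤ.- z) (pos-∸ d<n)) (2x-[x-[1+y]]≡x+[1+y] (+ n) (+ d)))
        (pos-∸ d<n))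
      A-vanishes : ∀ d → d < n → w (m′ ℕ.+ d) ≈ 0#
      A-vanishes d _ = trans (*-congʳ (A-above-diagonal i<n+1+m′+d)) (zeroˡ _)
        where i<n+1+m′+d = ℕₚ.<-≤-trans i<size (ℕₚ.+-monoʳ-≤ n (s≤s (ℕₚ.m≤m+n m′ d)))
      B-vanishes : ∀ d → d < m′ → w (n ℕ.+ d) ≈ 0#
      B-vanishes d _ = trans (*-congˡ (reflexive (≡.cong (λ z → B z (+ k)) (i-[1+i+d]≡-[1+d] n d)))) (zeroʳ _)

    A∘B×≈AB : ∀ {i} k → i < size → ∑ size (foldedTerm i k) ≈ ∑ size (abTerm i k)
    A∘B×≈AB {i} k i<size = begin
      ∑ size G                                                 ≈⟨ ∑-split n (suc m′) G ⟩
      ∑ n G + (G (n ℕ.+ 0) + ∑ m′ (G ∘ above))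
        ≈⟨ +-cong (∑-cong< n left) (+-cong middle (∑-cong m′ right)) ⟩
      ∑ n (λ j → g j - u j) + (g (n ℕ.+ 0) + ∑ m′ (λ d → g (above d) + v (above d)))
        ≈⟨ +-cong (trans (∑-distrib-+ n g (λ j → - u j)) (+-congˡ (∑-neg n u)))
                  (+-congˡ (∑-distrib-+ m′ (g ∘ above) (v ∘ above))) ⟩
      (∑ n g - ∑ n u) + (g (n ℕ.+ 0) + (∑ m′ (g ∘ above) + ∑ m′ (v ∘ above)))
        ≈⟨ +-congˡ (+-congˡ (+-congˡ (∑-reflect k i<size))) ⟩
      (∑ n g - ∑ n u) + (g (n ℕ.+ 0) + (∑ m′ (g ∘ above) + ∑ n u))
        ≈⟨ [x-u]+[y+[z+u]]≈x+[y+z] _ _ _ _ ⟩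
      ∑ n g + (g (n ℕ.+ 0) + ∑ m′ (g ∘ above))                 ≈⟨ ∑-split n (suc m′) g ⟨
      ∑ size g                                                 ∎
      where
      G = foldedTerm i k
      g = abTerm i k
      u = A∘-correction i k
      v = B×-correction i k
      above : ℕ → ℕ
      above d = n ℕ.+ suc d
      left : ∀ j → j < n → G j ≈ g j - u j
      left j j<n = begin
        G j                                                       ≡⟨ ≡.cong₂ _*_ (A∘-< (+ i) j<n) (B×-≤ (+ k) (ℕₚ.<⇒≤ j<n)) ⟩
        (A (+ i) (+ j) - A (+ i) (two-n ℤ.- + j)) * B (+ j) (+ k) ≈⟨ distribʳ _ _ _ ⟩
        g j + (- A (+ i) (two-n ℤ.- + j)) * B (+ j) (+ k)         ≈⟨ +-congˡ (-‿distribˡ-* _ _) ⟨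
        g j - u j                                                 ∎
      middle : G (n ℕ.+ 0) ≈ g (n ℕ.+ 0)
      middle = reflexive (≡.cong₂ _*_ (A∘-≥ (+ i) (ℕₚ.m≤m+n n 0)) (B×-≤ (+ k) (ℕₚ.≤-reflexive (ℕₚ.+-identityʳ n))))
      right : ∀ d → G (above d) ≈ g (above d) + v (above d)
      right d = trans (reflexive (≡.cong₂ _*_ (A∘-≥ (+ i) (ℕₚ.m≤m+n n (suc d))) (B×-> (+ k) (ℕₚ.m<m+n n (s≤s z≤n)))))
                      (distribˡ _ _ _)

    identity-≢ : ∀ {i k} → i ≢ k → identity i k ≈ 0#
    identity-≢ {i} {k} i≢k = reflexive (≡.cong (λ b → if b then 1# else 0#) (dec-false (i Fin.≟ k) i≢k))

    identity-diagonal : ∀ i → identity i i ≈ 1#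
    identity-diagonal i = reflexive (≡.cong (λ b → if b then 1# else 0#) (dec-true (i Fin.≟ i) ≡.refl))

    product≈identity : ∀ i k → product i k ≈ identity i k
    product≈identity i k = begin
      product i k                      ≡⟨ Σ≡∑ size (foldedTerm (Fin.toℕ i) (Fin.toℕ k)) ⟩
      ∑ size (foldedTerm i′ (Fin.toℕ k)) ≈⟨ A∘B×≈AB (Fin.toℕ k) (Finₚ.toℕ<n i) ⟩
      ∑ size (abTerm i′ (Fin.toℕ k))     ≈⟨ AB≈identity (ℕₚ.<-cmp i′ (Fin.toℕ k)) ⟩
      identity i k                     ∎
      where
      i′ = Fin.toℕ i
      AB≈identity : Tri (i′ < Fin.toℕ k) (i′ ≡ Fin.toℕ k) (Fin.toℕ k < i′) →
                    ∑ size (abTerm i′ (Fin.toℕ k)) ≈ identity i k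
      AB≈identity (tri< i<k _ _) =
        trans (AB-above-diagonal i<k) (sym (identity-≢ (ℕₚ.<⇒≢ i<k ∘ ≡.cong Fin.toℕ)))
      AB≈identity (tri> _ _ k<i) =
        trans (AB-below-diagonal k<i (Finₚ.toℕ<n i)) (sym (identity-≢ (ℕₚ.<⇒≢ k<i ∘ ≡.sym ∘ ≡.cong Fin.toℕ)))
      AB≈identity (tri≈ _ i≡k _) with Finₚ.toℕ-injective i≡k
      ... | ≡.refl = trans (AB-diagonal (Finₚ.toℕ<n i)) (sym (identity-diagonal i))

-- Imported only here, as inside JacobiProperties _+_ is the ring addition.
open import Data.Nat using (_+_)

mainTheorem12 : ∀ {c ℓ} (R : CommutativeRing c ℓ)
                  (h : ℕ → ℤ → CommutativeRing.Carrier R)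
                  (n m : ℕ) → 1 ≤ n → 1 ≤ m →
                  (i k : Fin (n + m)) →
                  CommutativeRing._≈_ R
                    (Jacobi.Matrices.product R h n m i k)
                    (Jacobi.Matrices.identity R h n m i k)
mainTheorem12 R h n (suc m′) _ _ = JacobiProperties.Entries.product≈identity R h n m′
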